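{- Let $q>2$ be a prime power, $n$ a positive integer, $F=\mathbb{F}_{q^{2n+1}}$, and let $W$, $\mathrm{PG}(W)$, $\mathcal{V}_{\alpha_1,\dots,\alpha_n}$, $\psi_{\alpha_1,\dots,\alpha_n}$ and $\tilde\phi$ be as in the context. Then: 1) for all $\alpha_1,\dots,\alpha_n\in F^*$, $\psi_{\alpha_1,\dots,\alpha_n}$ maps $\mathcal{V}_{1,\dots,1}$ to $\mathcal{V}_{\alpha_1,\dots,\alpha_n}$; 2) $\langle\tilde\phi\rangle$ is a group of order $\frac{q^{2n+1}-1}{q-1}$ acting regularly on the points of $\mathcal{V}_{\alpha_1,\dots,\alpha_n}$, for all $\alpha_1,\dots,\alpha_n\in F^*$.
   Context: For $a_0,\dots,a_n\in F$, $M(a_0,\dots,a_n)=(m_{ij})_{0\le i,j\le 2n}$ is the symmetric $(2n+1)\times(2n+1)$ matrix over $F$ with, for $0\le i\le j\le 2n$ and $d=j-i$: $m_{ij}=a_d^{q^i}$ if $d\le n$, and $m_{ij}=a_{2n+1-d}^{q^j}$ if $d>n$; and $m_{ji}=m_{ij}$. $W=\{M(a_0,\dots,a_n):a_i\in F\}$ is an $\mathbb{F}_q$-vector space of dimension $(n+1)(2n+1)$, and $\mathrm{PG}(W)$ is its projective space (points are $1$-dimensional $\mathbb{F}_q$-subspaces). For $\alpha_1,\dots,\alpha_n\in F^*$, $\mathcal{V}_{\alpha_1,\dots,\alpha_n}$ is the set of points of $\mathrm{PG}(W)$ spanned by $M(x^2,\alpha_1x^{q+1},\alpha_2x^{q^2+1},\dots,\alpha_nx^{q^n+1})$,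 $x\in F^*$ ($\mathcal{V}_{1,\dots,1}$ is the standard Veronese variety). $\psi_{\alpha_1,\dots,\alpha_n}$ is the projectivity of $\mathrm{PG}(W)$ induced by $M(a_0,a_1,\dots,a_n)\mapsto M(a_0,\alpha_1a_1,\dots,\alpha_na_n)$, and, for a primitive element $\eta$ of $F$, $\tilde\phi$ is the projectivity induced by $M(a_0,a_1,\dots,a_n)\mapsto M(\eta^2a_0,\eta^{q+1}a_1,\dots,\eta^{q^n+1}a_n)$. -}

module Defs where

open import Level using (Level)
open import Algebra.Bundles using (CommutativeRing)
open import Data.Nat using (ℕ; zero; suc; _+_; _*_; _∸_; _^_; _≤_; _<_; _≤?_; _<?_)
open import Data.Fin using (Fin; fromℕ<; toℕ)
import Data.Fin as Fin
open import Data.Product using (Σ; _×_; ∃)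
open import Relation.Nullary using (¬_; yes; no)
open import Relation.Binary.PropositionalEquality using (_≡_) renaming (setoid to ≡setoid)
open import Function.Bundles using (Bijection)

-- Everything is relative to a commutative ring R (later assumed to be the
-- field F = F_{q^{2n+1}}), the prime power q and the integer n.
module Construction {c ℓ : Level} (R : CommutativeRing c ℓ) (q n : ℕ) where
  open CommutativeRing R renaming (_*_ to _·_; _+_ to _⊕_)

  pow : Carrier → ℕ → Carrier
  pow x zero = 1#
  pow x (suc k) = x · pow x k

  frob : ℕ → Carrier → Carrier
  frob i x = pow x (q ^ i)

  InFq : Carrier → Set ℓ
  InFq x = pow x q ≈ x

  IsField : Set (c Level.⊔ ℓ)
  IsField = (¬ (1# ≈ 0#)) × (∀ x → ¬ (x ≈ 0#) → Σ Carrier λ y → x · y ≈ 1#)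

  IsPrimitive : Carrier → Set (c Level.⊔ ℓ)
  IsPrimitive η = ¬ (η ≈ 0#) × (∀ x → ¬ (x ≈ 0#) → Σ ℕ λ k → pow η k ≈ x)

  Coeffs : Set c
  Coeffs = Fin (suc n) → Carrier

  dim : ℕ
  dim = suc (n + n)

  Mat : Set c
  Mat = Fin dim → Fin dim → Carrier

  -- a_d, for d ≤ n (0 outside the range; never used there)
  at : Coeffs → ℕ → Carrier
  at a d with d <? suc n
  ... | yes p = a (fromℕ< p)
  ... | no _  = 0#

  entry≤ : Coeffs → ℕ → ℕ → Carrier
  entry≤ a i j with (j ∸ i) ≤? n
  ... | yes _ = frob i (at a (j ∸ i))
  ... | no _  = frob j (at a (dim ∸ (j ∸ i)))

  M : Coeffs → Mat
  M a i j with toℕ i ≤? toℕ j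
  ... | yes _ = entry≤ a (toℕ i) (toℕ j)
  ... | no _  = entry≤ a (toℕ j) (toℕ i)

  IsPoint : Coeffs → Set ℓ
  IsPoint a = ¬ (∀ i j → M a i j ≈ 0#)

  SamePoint : Mat → Mat → Set (c Level.⊔ ℓ)
  SamePoint A B = Σ Carrier λ t → InFq t × (¬ (t ≈ 0#)) × (∀ i j → B i j ≈ t · A i j)

  ext : (Fin n → Carrier) → Coeffs
  ext α Fin.zero = 1#
  ext α (Fin.suc k) = α k

  ones : Fin n → Carrier
  ones _ = 1#

  vpt : (Fin n → Carrier) → Carrier → Coeffs
  vpt α x i = ext α i · pow x (q ^ toℕ i + 1)

  InV : (Fin n → Carrier) → Coeffs → Set (c Level.⊔ ℓ)
  InV α a = Σ Carrier λ x → (¬ (x ≈ 0#)) × SamePoint (M (vpt α x)) (M a)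

  ψ : (Fin n → Carrier) → Coeffs → Coeffs
  ψ α a i = ext α i · a i

  φ : Carrier → Coeffs → Coeffs
  φ η a i = pow η (q ^ toℕ i + 1) · a i

  φ^ : Carrier → ℕ → Coeffs → Coeffs
  φ^ η zero a = a
  φ^ η (suc k) a = φ η (φ^ η k a)

  -- N = (q^{2n+1} - 1)/(q - 1), stated without division
  IsOrbitSize : ℕ → Set
  IsOrbitSize N = N * (q ∸ 1) ≡ q ^ dim ∸ 1

  HasCard : ℕ → Set (c Level.⊔ ℓ)
  HasCard m = Bijection (≡setoid (Fin m)) setoid

{-# OPTIONS --safe #-}
-- Every map involved is coefficientwise multiplication: ψ_α multiplies by (1, α₁, …, α_n),
-- φ̃^k by scaling η^k = ((η^k)^{q^i+1})_i, and the Veronese coefficients satisfy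
-- vpt α (u x) = scaling u ⊙ vpt α x.  M commutes with coefficientwise products and with
-- F_q-scalars, and scaling t is the constant t² for t ∈ F_q; so V_α is the orbit of a point
-- under x ↦ ηx, and vpt α x, vpt α y span the same point iff y/x ∈ F_q^* (compare the
-- entries x² and α₁x^{q+1}).  Since η has order q^{2n+1} − 1 = N(q − 1), η^k ∈ F_q iff N ∣ k,
-- whence φ̃ has order N and ⟨φ̃⟩ acts regularly on V_α.
module Submission where

open import Level using (Level)
open import Algebra.Bundles using (CommutativeRing)
import Algebra.Properties.CommutativeSemigroup as CommSemigroupProperties
open import Data.Fin using (Fin; toℕ)
import Data.Fin as Fin
import Data.Fin.Properties as FinP
open import Data.Nat using (ℕ; zero; suc; _^_; _≤_; _<_; _∸_; _≤?_; _<?_)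
import Data.Nat as ℕ
open import Data.Nat.DivMod using (_%_; _/_; m≡m%n+[m/n]*n; m%n<n)
open import Data.Nat.Primality using (Prime)
import Data.Nat.Properties as ℕ
open import Data.Product using (Σ; _×_; _,_; proj₁; proj₂)
open import Data.Sum using (inj₁; inj₂)
open import Function.Bundles using (Bijection)
open import Relation.Binary.Bundles using (Setoid)
open import Relation.Binary.PropositionalEquality as ≡ using (_≡_)
import Relation.Binary.Reasoning.Setoid as SetoidReasoning
open import Relation.Nullary using (¬_; yes; no; contradiction)

open import Defs

module Powers {c ℓ : Level} (R : CommutativeRing c ℓ) (q n : ℕ) where
  open CommutativeRing R
  open Construction R q n
  open SetoidReasoning setoid
  open CommSemigroupProperties *-commutativeSemigroup using (interchange)

  pow-congˡ : ∀ {x y} k → x ≈ y → pow x k ≈ pow y k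
  pow-congˡ zero x≈y = refl
  pow-congˡ (suc k) x≈y = *-cong x≈y (pow-congˡ k x≈y)

  pow-congʳ : ∀ x {m k} → m ≡ k → pow x m ≈ pow x k
  pow-congʳ x ≡.refl = refl

  pow-identityʳ : ∀ x → pow x 1 ≈ x
  pow-identityʳ = *-identityʳ

  pow-1# : ∀ k → pow 1# k ≈ 1#
  pow-1# zero = refl
  pow-1# (suc k) = trans (*-identityˡ _) (pow-1# k)

  pow-+ : ∀ x m k → pow x (m ℕ.+ k) ≈ pow x m * pow x k
  pow-+ x zero k = sym (*-identityˡ _)
  pow-+ x (suc m) k = trans (*-congˡ (pow-+ x m k)) (sym (*-assoc _ _ _))

  pow-distrib : ∀ x y k → pow (x * y) k ≈ pow x k * pow y k
  pow-distrib x y zero = sym (*-identityˡ _)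
  pow-distrib x y (suc k) = trans (*-congˡ (pow-distrib x y k)) (interchange x y _ _)

  pow-* : ∀ x m k → pow x (m ℕ.* k) ≈ pow (pow x m) k
  pow-* x zero k = sym (pow-1# k)
  pow-* x (suc m) k = begin
    pow x (k ℕ.+ m ℕ.* k)      ≈⟨ pow-+ x k (m ℕ.* k) ⟩
    pow x k * pow x (m ℕ.* k)  ≈⟨ *-congˡ (pow-* x m k) ⟩
    pow x k * pow (pow x m) k  ≈⟨ pow-distrib x (pow x m) k ⟨
    pow (x * pow x m) k        ∎

  pow-divMod : ∀ x k e .{{_ : ℕ.NonZero e}} → pow x k ≈ pow x (k % e) * pow (pow x e) (k / e)
  pow-divMod x k e = begin
    pow x k                                ≈⟨ pow-congʳ x (m≡m%n+[m/n]*n k e) ⟩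
    pow x (k % e ℕ.+ (k / e) ℕ.* e)        ≈⟨ pow-+ x (k % e) _ ⟩
    pow x (k % e) * pow x ((k / e) ℕ.* e)  ≈⟨ *-congˡ (pow-congʳ x (ℕ.*-comm (k / e) e)) ⟩
    pow x (k % e) * pow x (e ℕ.* (k / e))  ≈⟨ *-congˡ (pow-* x e (k / e)) ⟩
    pow x (k % e) * pow (pow x e) (k / e)  ∎

  InFq-1# : InFq 1#
  InFq-1# = pow-1# q

  InFq-* : ∀ {s t} → InFq s → InFq t → InFq (s * t)
  InFq-* {s} {t} s∈Fq t∈Fq = trans (pow-distrib s t q) (*-cong s∈Fq t∈Fq)

  InFq-pow : ∀ {s} → InFq s → ∀ k → InFq (pow s k)
  InFq-pow {s} s∈Fq k = begin
    pow (pow s k) q  ≈⟨ pow-* s k q ⟨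
    pow s (k ℕ.* q)  ≈⟨ pow-congʳ s (ℕ.*-comm k q) ⟩
    pow s (q ℕ.* k)  ≈⟨ pow-* s q k ⟩
    pow (pow s q) k  ≈⟨ pow-congˡ k s∈Fq ⟩
    pow s k          ∎

  InFq⇒frob-fixed : ∀ {s} → InFq s → ∀ k → frob k s ≈ s
  InFq⇒frob-fixed {s} s∈Fq zero = pow-identityʳ s
  InFq⇒frob-fixed {s} s∈Fq (suc k) = begin
    pow s (q ℕ.* q ^ k)    ≈⟨ pow-* s q (q ^ k) ⟩
    pow (pow s q) (q ^ k)  ≈⟨ pow-congˡ (q ^ k) s∈Fq ⟩
    frob k s               ≈⟨ InFq⇒frob-fixed s∈Fq k ⟩
    s                      ∎

module Coefficients {c ℓ : Level} (R : CommutativeRing c ℓ) (q n : ℕ) where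
  open CommutativeRing R
  open Construction R q n
  open Powers R q n
  open CommSemigroupProperties *-commutativeSemigroup using (interchange; x∙yz≈y∙xz)

  infixl 7 _⊙_
  _⊙_ : Coeffs → Coeffs → Coeffs
  (a ⊙ b) i = a i * b i

  -- The diagonal coefficient vector (u², u^{q+1}, …, u^{q^n+1}): φ̃ = scaling η ⊙_ and
  -- vpt α x = ext α ⊙ scaling x.
  scaling : Carrier → Coeffs
  scaling u i = pow u (q ^ toℕ i ℕ.+ 1)

  -- G-zero accounts for the junk value 0# that `at` returns outside 0 … n.
  module _ (G : Carrier → Carrier → Carrier) (G-zero : G 0# 0# ≈ 0#)
           (frob-G : ∀ k x y → frob k (G x y) ≈ G (frob k x) (frob k y))
           {a b c : Coeffs} (c≈Gab : ∀ d → c d ≈ G (a d) (b d)) where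

    private
      at-coeffwise : ∀ d → at c d ≈ G (at a d) (at b d)
      at-coeffwise d with d <? suc n
      ... | yes _ = c≈Gab _
      ... | no _  = sym G-zero

      entry≤-coeffwise : ∀ i j → entry≤ c i j ≈ G (entry≤ a i j) (entry≤ b i j)
      entry≤-coeffwise i j with (j ∸ i) ≤? n
      ... | yes _ = trans (pow-congˡ (q ^ i) (at-coeffwise (j ∸ i))) (frob-G i _ _)
      ... | no _  = trans (pow-congˡ (q ^ j) (at-coeffwise (dim ∸ (j ∸ i)))) (frob-G j _ _)

    M-coeffwise : ∀ i j → M c i j ≈ G (M a i j) (M b i j)
    M-coeffwise i j with toℕ i ≤? toℕ j
    ... | yes _ = entry≤-coeffwise (toℕ i) (toℕ j)
    ... | no _  = entry≤-coeffwise (toℕ j) (toℕ i)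

  M-cong : ∀ {a b} → (∀ d → a d ≈ b d) → ∀ i j → M a i j ≈ M b i j
  M-cong {a} {b} = M-coeffwise (λ _ y → y) refl (λ _ _ _ → refl) {b} {b} {a}

  M-⊙ : ∀ a b i j → M (a ⊙ b) i j ≈ M a i j * M b i j
  M-⊙ a b = M-coeffwise _*_ (zeroˡ 0#) (λ k x y → pow-distrib x y (q ^ k)) (λ _ → refl)

  M-scale : ∀ {s a b} → InFq s → (∀ d → b d ≈ s * a d) → ∀ i j → M b i j ≈ s * M a i j
  M-scale {s} {a} {b} s∈Fq = M-coeffwise (λ _ y → s * y) (zeroʳ s)
    (λ k x y → trans (pow-distrib s y (q ^ k)) (*-congʳ (InFq⇒frob-fixed s∈Fq k))) {a} {a} {b}

  scaling-* : ∀ u v d → scaling (u * v) d ≈ (scaling u ⊙ scaling v) d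
  scaling-* u v d = pow-distrib u v (q ^ toℕ d ℕ.+ 1)

  scaling-InFq : ∀ {t} → InFq t → ∀ d → scaling t d ≈ t * t
  scaling-InFq {t} t∈Fq d =
    trans (pow-+ t (q ^ toℕ d) 1) (*-cong (InFq⇒frob-fixed t∈Fq (toℕ d)) (pow-identityʳ t))

  vpt-* : ∀ α u x d → vpt α (u * x) d ≈ (scaling u ⊙ vpt α x) d
  vpt-* α u x d = trans (*-congˡ (scaling-* u x d)) (x∙yz≈y∙xz _ _ _)

  vpt-cong : ∀ α {x y} → x ≈ y → ∀ d → vpt α x d ≈ vpt α y d
  vpt-cong α x≈y d = *-congˡ (pow-congˡ (q ^ toℕ d ℕ.+ 1) x≈y)

  φ^-scaling : ∀ η k a d → φ^ η k a d ≈ (scaling (pow η k) ⊙ a) d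
  φ^-scaling η zero a d = sym (trans (*-congʳ (pow-1# (q ^ toℕ d ℕ.+ 1))) (*-identityˡ (a d)))
  φ^-scaling η (suc k) a d = begin
    scaling η d * φ^ η k a d                     ≈⟨ *-congˡ (φ^-scaling η k a d) ⟩
    scaling η d * (scaling (pow η k) d * a d)    ≈⟨ *-assoc _ _ _ ⟨
    (scaling η d * scaling (pow η k) d) * a d    ≈⟨ *-congʳ (scaling-* η (pow η k) d) ⟨
    scaling (pow η (suc k)) d * a d              ∎
    where open SetoidReasoning setoid

module Field {c ℓ : Level} (R : CommutativeRing c ℓ) (q n : ℕ)
             (isField : Construction.IsField R q n) where
  open CommutativeRing R
  open Construction R q n
  open Powers R q n
  open SetoidReasoning setoid

  1≉0 : ¬ 1# ≈ 0#
  1≉0 = proj₁ isField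

  inv : ∀ x → ¬ x ≈ 0# → Carrier
  inv x x≉0 = proj₁ (proj₂ isField x x≉0)

  *-inverseʳ : ∀ x (x≉0 : ¬ x ≈ 0#) → x * inv x x≉0 ≈ 1#
  *-inverseʳ x x≉0 = proj₂ (proj₂ isField x x≉0)

  *-inverseˡ : ∀ x (x≉0 : ¬ x ≈ 0#) → inv x x≉0 * x ≈ 1#
  *-inverseˡ x x≉0 = trans (*-comm _ x) (*-inverseʳ x x≉0)

  *-cancelˡ : ∀ {x a b} → ¬ x ≈ 0# → x * a ≈ x * b → a ≈ b
  *-cancelˡ {x} {a} {b} x≉0 xa≈xb = begin
    a                  ≈⟨ *-identityˡ a ⟨
    1# * a             ≈⟨ *-congʳ (*-inverseˡ x x≉0) ⟨
    (x⁻¹ * x) * a      ≈⟨ *-assoc x⁻¹ x a ⟩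
    x⁻¹ * (x * a)      ≈⟨ *-congˡ xa≈xb ⟩
    x⁻¹ * (x * b)      ≈⟨ *-assoc x⁻¹ x b ⟨
    (x⁻¹ * x) * b      ≈⟨ *-congʳ (*-inverseˡ x x≉0) ⟩
    1# * b             ≈⟨ *-identityˡ b ⟩
    b                  ∎
    where x⁻¹ = inv x x≉0

  y≈y/x*x : ∀ y x (x≉0 : ¬ x ≈ 0#) → y ≈ (y * inv x x≉0) * x
  y≈y/x*x y x x≉0 = begin
    y                    ≈⟨ *-identityʳ y ⟨
    y * 1#               ≈⟨ *-congˡ (*-inverseˡ x x≉0) ⟨
    y * (inv x x≉0 * x)  ≈⟨ *-assoc y _ x ⟨
    (y * inv x x≉0) * x  ∎

  *-cancelʳ : ∀ {x a b} → ¬ x ≈ 0# → a * x ≈ b * x → a ≈ b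
  *-cancelʳ x≉0 ax≈bx = *-cancelˡ x≉0 (trans (*-comm _ _) (trans ax≈bx (*-comm _ _)))

  *-nonzero : ∀ {x y} → ¬ x ≈ 0# → ¬ y ≈ 0# → ¬ x * y ≈ 0#
  *-nonzero {x} {y} x≉0 y≉0 xy≈0 = y≉0 (*-cancelˡ x≉0 (trans xy≈0 (sym (zeroʳ x))))

  pow-nonzero : ∀ {x} k → ¬ x ≈ 0# → ¬ pow x k ≈ 0#
  pow-nonzero zero x≉0 = 1≉0
  pow-nonzero (suc k) x≉0 = *-nonzero x≉0 (pow-nonzero k x≉0)

  inv-nonzero : ∀ x (x≉0 : ¬ x ≈ 0#) → ¬ inv x x≉0 ≈ 0#
  inv-nonzero x x≉0 x⁻¹≈0 =
    1≉0 (trans (sym (*-inverseʳ x x≉0)) (trans (*-congˡ x⁻¹≈0) (zeroʳ x)))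

  InFq-inv : ∀ {s} (s≉0 : ¬ s ≈ 0#) → InFq s → InFq (inv s s≉0)
  InFq-inv {s} s≉0 s∈Fq = *-cancelˡ s≉0 (begin
    s * pow s⁻¹ q          ≈⟨ *-congʳ s∈Fq ⟨
    pow s q * pow s⁻¹ q    ≈⟨ pow-distrib s s⁻¹ q ⟨
    pow (s * s⁻¹) q        ≈⟨ pow-congˡ q (*-inverseʳ s s≉0) ⟩
    pow 1# q               ≈⟨ pow-1# q ⟩
    1#                     ≈⟨ *-inverseʳ s s≉0 ⟨
    s * s⁻¹                ∎)
    where s⁻¹ = inv s s≉0

module Points {c ℓ : Level} (R : CommutativeRing c ℓ) (q n : ℕ)
              (isField : Construction.IsField R q n) where
  open CommutativeRing R
  open Construction R q n
  open Powers R q n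
  open Coefficients R q n
  open Field R q n isField
  open SetoidReasoning setoid

  infix 4 _~_
  _~_ : Coeffs → Coeffs → Set (c Level.⊔ ℓ)
  a ~ b = SamePoint (M a) (M b)

  SamePoint-refl : ∀ {A} → SamePoint A A
  SamePoint-refl = 1# , InFq-1# , 1≉0 , λ _ _ → sym (*-identityˡ _)

  SamePoint-sym : ∀ {A B} → SamePoint A B → SamePoint B A
  SamePoint-sym {A} {B} (t , t∈Fq , t≉0 , B≈tA) =
    t⁻¹ , InFq-inv t≉0 t∈Fq , inv-nonzero t t≉0 , λ i j → begin
      A i j              ≈⟨ *-identityˡ (A i j) ⟨
      1# * A i j         ≈⟨ *-congʳ (*-inverseˡ t t≉0) ⟨
      (t⁻¹ * t) * A i j  ≈⟨ *-assoc t⁻¹ t (A i j) ⟩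
      t⁻¹ * (t * A i j)  ≈⟨ *-congˡ (B≈tA i j) ⟨
      t⁻¹ * B i j        ∎
    where t⁻¹ = inv t t≉0

  SamePoint-trans : ∀ {A B C} → SamePoint A B → SamePoint B C → SamePoint A C
  SamePoint-trans (s , s∈Fq , s≉0 , B≈sA) (t , t∈Fq , t≉0 , C≈tB) =
    t * s , InFq-* t∈Fq s∈Fq , *-nonzero t≉0 s≉0 ,
    λ i j → trans (C≈tB i j) (trans (*-congˡ (B≈sA i j)) (sym (*-assoc t s _)))

  ~-setoid : Setoid c (c Level.⊔ ℓ)
  ~-setoid = record
    { Carrier = Coeffs
    ; _≈_ = _~_
    ; isEquivalence = record { refl = SamePoint-refl ; sym = SamePoint-sym ; trans = SamePoint-trans }
    }

  ~-reflexive : ∀ {a b} → (∀ d → a d ≈ b d) → a ~ b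
  ~-reflexive a≈b = 1# , InFq-1# , 1≉0 , λ i j → trans (M-cong (λ d → sym (a≈b d)) i j) (sym (*-identityˡ _))

  ~-⊙ : ∀ {a b} c → a ~ b → c ⊙ a ~ c ⊙ b
  ~-⊙ {a} {b} c (t , t∈Fq , t≉0 , Mb≈tMa) = t , t∈Fq , t≉0 , λ i j → begin
    M (c ⊙ b) i j          ≈⟨ M-⊙ c b i j ⟩
    M c i j * M b i j      ≈⟨ *-congˡ (Mb≈tMa i j) ⟩
    M c i j * (t * M a i j) ≈⟨ x∙yz≈y∙xz _ _ _ ⟩
    t * (M c i j * M a i j) ≈⟨ *-congˡ (M-⊙ c a i j) ⟨
    t * M (c ⊙ a) i j      ∎
    where open CommSemigroupProperties *-commutativeSemigroup using (x∙yz≈y∙xz)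

  ~-scaling-InFq : ∀ {t} → InFq t → ¬ t ≈ 0# → ∀ a → a ~ scaling t ⊙ a
  ~-scaling-InFq {t} t∈Fq t≉0 a = t * t , InFq-* t∈Fq t∈Fq , *-nonzero t≉0 t≉0 ,
    M-scale (InFq-* t∈Fq t∈Fq) (λ d → *-congʳ (scaling-InFq t∈Fq d))

  vpt~vpt-InFq : ∀ {t} → InFq t → ¬ t ≈ 0# → ∀ α x → vpt α x ~ vpt α (t * x)
  vpt~vpt-InFq t∈Fq t≉0 α x =
    SamePoint-trans (~-scaling-InFq t∈Fq t≉0 (vpt α x)) (~-reflexive (λ d → sym (vpt-* α _ x d)))

  vpt~φ^ : ∀ {α x a} η k → vpt α x ~ a → vpt α (pow η k * x) ~ φ^ η k a
  vpt~φ^ {α} {x} {a} η k x~a = SamePoint-trans (~-reflexive (vpt-* α (pow η k) x))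
    (SamePoint-trans (~-⊙ (scaling (pow η k)) x~a) (~-reflexive (λ d → sym (φ^-scaling η k a d))))

  vpt-IsPoint : ∀ α {x} → ¬ x ≈ 0# → IsPoint (vpt α x)
  vpt-IsPoint α x≉0 M≈0 =
    *-nonzero (*-nonzero 1≉0 (pow-nonzero 2 x≉0)) 1≉0 (M≈0 Fin.zero Fin.zero)

  ψ-vpt-ones : ∀ α x d → ψ α (vpt ones x) d ≈ vpt α x d
  ψ-vpt-ones α x d = *-congˡ (trans (*-congʳ (ext-ones d)) (*-identityˡ _))
    where
    ext-ones : ∀ d → ext ones d ≈ 1#
    ext-ones Fin.zero = refl
    ext-ones (Fin.suc _) = refl

  ψ-InV : ∀ α a → InV ones a → InV α (ψ α a)
  ψ-InV α a (x , x≉0 , x~a) =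
    x , x≉0 , SamePoint-trans (~-reflexive (λ d → sym (ψ-vpt-ones α x d))) (~-⊙ (ext α) x~a)

  ψ-InV-surjective : ∀ α b → InV α b → Σ Coeffs λ a → InV ones a × ψ α a ~ b
  ψ-InV-surjective α b (x , x≉0 , x~b) =
    vpt ones x , (x , x≉0 , SamePoint-refl) , SamePoint-trans (~-reflexive (ψ-vpt-ones α x)) x~b

  φ-InV : ∀ {η} → ¬ η ≈ 0# → ∀ α a → InV α a → InV α (φ η a)
  φ-InV {η} η≉0 α a (x , x≉0 , x~a) =
    pow η 1 * x , *-nonzero (pow-nonzero 1 η≉0) x≉0 , vpt~φ^ η 1 x~a

module Veronese {c ℓ : Level} (R : CommutativeRing c ℓ) (q n₁ : ℕ)
                (isField : Construction.IsField R q (suc n₁)) where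
  open CommutativeRing R
  open Construction R q (suc n₁)
  open Powers R q (suc n₁)
  open Coefficients R q (suc n₁)
  open Field R q (suc n₁) isField
  open Points R q (suc n₁) isField
  open SetoidReasoning setoid

  -- Entries (0,0) and (0,1) of M (vpt α x) are x² and α₁ x^{q+1}; a common F_q-factor
  -- between them for x = z and x = w z forces w² = w^{q+1}.
  vpt~vpt⇒InFq : ∀ {α w z} → ¬ α Fin.zero ≈ 0# → ¬ w ≈ 0# → ¬ z ≈ 0# →
                 vpt α z ~ vpt α (w * z) → InFq w
  vpt~vpt⇒InFq {α} {w} {z} α₁≉0 w≉0 z≉0 (t , _ , _ , Mwz≈tMz) = begin
    pow w q            ≈⟨ pow-congʳ w (ℕ.*-identityʳ q) ⟨
    pow w (q ℕ.* 1)    ≈⟨ *-cancelʳ (pow-nonzero 1 w≉0) q+1≈2 ⟩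
    pow w 1            ≈⟨ pow-identityʳ w ⟩
    w                  ∎
    where
    scaling≈t : ∀ d → ¬ vpt α z d ≈ 0# → vpt α (w * z) d * 1# ≈ t * (vpt α z d * 1#) →
                scaling w d ≈ t
    scaling≈t d z-entry≉0 entry≈ = *-cancelʳ z-entry≉0 (begin
      scaling w d * vpt α z d  ≈⟨ vpt-* α w z d ⟨
      vpt α (w * z) d          ≈⟨ *-identityʳ _ ⟨
      vpt α (w * z) d * 1#     ≈⟨ entry≈ ⟩
      t * (vpt α z d * 1#)     ≈⟨ *-congˡ (*-identityʳ _) ⟩
      t * vpt α z d            ∎)

    w^[q+1]≈t : scaling w (Fin.suc Fin.zero) ≈ t
    w^[q+1]≈t = scaling≈t (Fin.suc Fin.zero) (*-nonzero α₁≉0 (pow-nonzero (q ℕ.* 1 ℕ.+ 1) z≉0))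
                       (Mwz≈tMz Fin.zero (Fin.suc Fin.zero))

    w²≈t : scaling w Fin.zero ≈ t
    w²≈t = scaling≈t Fin.zero (*-nonzero 1≉0 (pow-nonzero 2 z≉0)) (Mwz≈tMz Fin.zero Fin.zero)

    q+1≈2 : pow w (q ℕ.* 1) * pow w 1 ≈ pow w 1 * pow w 1
    q+1≈2 = begin
      pow w (q ℕ.* 1) * pow w 1     ≈⟨ pow-+ w (q ℕ.* 1) 1 ⟨
      scaling w (Fin.suc Fin.zero)  ≈⟨ w^[q+1]≈t ⟩
      t                             ≈⟨ w²≈t ⟨
      scaling w Fin.zero            ≈⟨ pow-+ w 1 1 ⟩
      pow w 1 * pow w 1             ∎

module PrimitiveElement {c ℓ : Level} (R : CommutativeRing c ℓ) (q n : ℕ)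
                        (isField : Construction.IsField R q n)
                        {η : CommutativeRing.Carrier R} (η-primitive : Construction.IsPrimitive R q n η)
                        {Q′ : ℕ} (card : Construction.HasCard R q n (suc Q′)) where
  open CommutativeRing R
  open Construction R q n
  open Powers R q n
  open Field R q n isField
  open Bijection card using (to; injective; strictlySurjective)
  open SetoidReasoning setoid

  η≉0 : ¬ η ≈ 0#
  η≉0 = proj₁ η-primitive

  private
    index : Carrier → Fin (suc Q′)
    index y = proj₁ (strictlySurjective y)

    to-index : ∀ y → to (index y) ≈ y
    to-index y = proj₂ (strictlySurjective y)

    to≉0 : ∀ {i} → ¬ i ≡ index 0# → ¬ to i ≈ 0#
    to≉0 i≢0 to-i≈0 = i≢0 (injective (trans to-i≈0 (sym (to-index 0#))))

    log : ∀ i → ¬ i ≡ index 0# → ℕ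
    log i i≢0 = proj₁ (proj₂ η-primitive (to i) (to≉0 i≢0))

    pow-log : ∀ i (i≢0 : ¬ i ≡ index 0#) → pow η (log i i≢0) ≈ to i
    pow-log i i≢0 = proj₂ (proj₂ η-primitive (to i) (to≉0 i≢0))

  -- If η^e = 1 then every nonzero element is η^k for some k < e, so log mod e is injective.
  order-≥ : ∀ e → 0 < e → pow η e ≈ 1# → Q′ ≤ e
  order-≥ e@(suc _) _ ηᵉ≈1 = ℕ.≤-pred (FinP.injective⇒≤ {f = residue} residue-injective)
    where
    pow-mod : ∀ k → pow η (k % e) ≈ pow η k
    pow-mod k = sym (begin
      pow η k                                ≈⟨ pow-divMod η k e ⟩
      pow η (k % e) * pow (pow η e) (k / e)  ≈⟨ *-congˡ (trans (pow-congˡ (k / e) ηᵉ≈1) (pow-1# (k / e))) ⟩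
      pow η (k % e) * 1#                     ≈⟨ *-identityʳ _ ⟩
      pow η (k % e)                          ∎)

    residue : Fin (suc Q′) → Fin (suc e)
    residue i with i Fin.≟ index 0#
    ... | yes _   = Fin.zero
    ... | no i≢0 = Fin.suc (Fin.fromℕ< (m%n<n (log i i≢0) e))

    residue-injective : ∀ {i j} → residue i ≡ residue j → i ≡ j
    residue-injective {i} {j} eq with i Fin.≟ index 0# | j Fin.≟ index 0#
    ... | yes i≡0 | yes j≡0 = ≡.trans i≡0 (≡.sym j≡0)
    ... | no i≢0  | no j≢0  = injective (begin
      to i                         ≈⟨ pow-log i i≢0 ⟨
      pow η (log i i≢0)            ≈⟨ pow-mod (log i i≢0) ⟨
      pow η (log i i≢0 % e)        ≈⟨ pow-congʳ η log-residues≡ ⟩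
      pow η (log j j≢0 % e)        ≈⟨ pow-mod (log j j≢0) ⟩
      pow η (log j j≢0)            ≈⟨ pow-log j j≢0 ⟩
      to j                         ∎)
      where
      log-residues≡ : log i i≢0 % e ≡ log j j≢0 % e
      log-residues≡ = ≡.trans (≡.sym (FinP.toℕ-fromℕ< _))
        (≡.trans (≡.cong toℕ (FinP.suc-injective eq)) (FinP.toℕ-fromℕ< _))

  private
    index-0≢index-ηⁱ : ∀ (i : Fin (suc Q′)) → ¬ index 0# ≡ index (pow η (toℕ i))
    index-0≢index-ηⁱ i eq = pow-nonzero (toℕ i) η≉0 (begin
      pow η (toℕ i)                ≈⟨ to-index (pow η (toℕ i)) ⟨
      to (index (pow η (toℕ i)))   ≡⟨ ≡.cong to (≡.sym eq) ⟩
      to (index 0#)                ≈⟨ to-index 0# ⟩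
      0#                           ∎)

    nonzero-power-index : Fin (suc Q′) → Fin Q′
    nonzero-power-index i = Fin.punchOut (index-0≢index-ηⁱ i)

  -- The Q′ + 1 powers η⁰, …, η^{Q′} are nonzero, so two of them coincide.
  order-≤ : Σ ℕ λ d → 0 < d × d ≤ Q′ × pow η d ≈ 1#
  order-≤ with FinP.pigeonhole (ℕ.n<1+n Q′) nonzero-power-index
  ... | i , j , i<j , eq = toℕ j ∸ toℕ i , ℕ.m<n⇒0<n∸m i<j , d≤Q′ , ηᵈ≈1
    where
    d≤Q′ : toℕ j ∸ toℕ i ≤ Q′
    d≤Q′ = ℕ.≤-trans (ℕ.m∸n≤m (toℕ j) (toℕ i)) (ℕ.<⇒≤pred (FinP.toℕ<n j))

    ηⁱ≈ηʲ : pow η (toℕ i) ≈ pow η (toℕ j)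
    ηⁱ≈ηʲ = begin
      pow η (toℕ i)              ≈⟨ to-index _ ⟨
      to (index (pow η (toℕ i))) ≡⟨ ≡.cong to (FinP.punchOut-injective (index-0≢index-ηⁱ i) (index-0≢index-ηⁱ j) eq) ⟩
      to (index (pow η (toℕ j))) ≈⟨ to-index _ ⟩
      pow η (toℕ j)              ∎

    ηᵈ≈1 : pow η (toℕ j ∸ toℕ i) ≈ 1#
    ηᵈ≈1 = *-cancelˡ (pow-nonzero (toℕ i) η≉0) (begin
      pow η (toℕ i) * pow η (toℕ j ∸ toℕ i)  ≈⟨ pow-+ η (toℕ i) _ ⟨
      pow η (toℕ i ℕ.+ (toℕ j ∸ toℕ i))      ≡⟨ ≡.cong (pow η) (ℕ.m+[n∸m]≡n (ℕ.<⇒≤ i<j)) ⟩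
      pow η (toℕ j)                          ≈⟨ ηⁱ≈ηʲ ⟨
      pow η (toℕ i)                          ≈⟨ *-identityʳ _ ⟨
      pow η (toℕ i) * 1#                     ∎)

  pow-card-pred : pow η Q′ ≈ 1#
  pow-card-pred with order-≤
  ... | d , 0<d , d≤Q′ , ηᵈ≈1 = trans (pow-congʳ η (ℕ.≤-antisym (order-≥ d 0<d ηᵈ≈1) d≤Q′)) ηᵈ≈1

module Orbit {c ℓ : Level} (R : CommutativeRing c ℓ) (q₁ n₁ : ℕ) .{{_ : ℕ.NonZero q₁}}
             (isField : Construction.IsField R (suc q₁) (suc n₁))
             {η : CommutativeRing.Carrier R} (η-primitive : Construction.IsPrimitive R (suc q₁) (suc n₁) η)
             {Q : ℕ} (card : Construction.HasCard R (suc q₁) (suc n₁) Q)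
             {N : ℕ} (N-orbitSize : N ℕ.* q₁ ≡ Q ∸ 1) where
  open CommutativeRing R
  open Construction R (suc q₁) (suc n₁)
  open Powers R (suc q₁) (suc n₁)
  open Coefficients R (suc q₁) (suc n₁)
  open Field R (suc q₁) (suc n₁) isField
  open Points R (suc q₁) (suc n₁) isField
  open Veronese R (suc q₁) n₁ isField
  open CommSemigroupProperties *-commutativeSemigroup using (xy∙z≈y∙xz)

  private
    q = suc q₁

    suc-pred-card : ∀ {Q} → HasCard Q → suc (Q ∸ 1) ≡ Q
    suc-pred-card {zero} card = contradiction (proj₁ (Bijection.strictlySurjective card 0#)) FinP.¬Fin0
    suc-pred-card {suc _} _ = ≡.refl

  open PrimitiveElement R q (suc n₁) isField η-primitive (≡.subst HasCard (≡.sym (suc-pred-card card)) card)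

  N-nonZero : ℕ.NonZero N
  N-nonZero with order-≤
  ... | _ , 0<d , d≤Q-1 , _ = ℕ.m*n≢0⇒m≢0 N {{ℕ.>-nonZero 0<Nq₁}}
    where
    0<Nq₁ : 0 < N ℕ.* q₁
    0<Nq₁ = ≡.subst (0 <_) (≡.sym N-orbitSize) (ℕ.<-≤-trans 0<d d≤Q-1)

  InFq-η^N : InFq (pow η N)
  InFq-η^N = begin
    pow (pow η N) q              ≈⟨ pow-* η N q ⟨
    pow η (N ℕ.* q)              ≡⟨ ≡.cong (pow η) (≡.trans (ℕ.*-suc N q₁) (ℕ.+-comm N _)) ⟩
    pow η (N ℕ.* q₁ ℕ.+ N)       ≈⟨ pow-+ η (N ℕ.* q₁) N ⟩
    pow η (N ℕ.* q₁) * pow η N   ≈⟨ *-congʳ (trans (pow-congʳ η N-orbitSize) pow-card-pred) ⟩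
    1# * pow η N                 ≈⟨ *-identityˡ _ ⟩
    pow η N                      ∎
    where open SetoidReasoning setoid

  InFq-η^d⇒N≤d : ∀ d → 0 < d → InFq (pow η d) → N ≤ d
  InFq-η^d⇒N≤d d 0<d η^d∈Fq = ℕ.*-cancelʳ-≤ N d q₁
    (≡.subst (_≤ d ℕ.* q₁) (≡.sym N-orbitSize) (order-≥ (d ℕ.* q₁) 0<dq₁ ηᵈ⁽q⁻¹⁾≈1))
    where
    0<dq₁ : 0 < d ℕ.* q₁
    0<dq₁ = ℕ.>-nonZero⁻¹ (d ℕ.* q₁) {{ℕ.m*n≢0 d q₁ {{ℕ.>-nonZero 0<d}}}}

    ηᵈ⁽q⁻¹⁾≈1 : pow η (d ℕ.* q₁) ≈ 1#
    ηᵈ⁽q⁻¹⁾≈1 = *-cancelˡ (pow-nonzero d η≉0) (begin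
      pow η d * pow η (d ℕ.* q₁)   ≈⟨ pow-+ η d (d ℕ.* q₁) ⟨
      pow η (d ℕ.+ d ℕ.* q₁)       ≡⟨ ≡.cong (pow η) (≡.sym (ℕ.*-suc d q₁)) ⟩
      pow η (d ℕ.* q)              ≈⟨ pow-* η d q ⟩
      pow (pow η d) q              ≈⟨ η^d∈Fq ⟩
      pow η d                      ≈⟨ *-identityʳ _ ⟨
      pow η d * 1#                 ∎)
      where open SetoidReasoning setoid

  private instance
    N≢0 : ℕ.NonZero N
    N≢0 = N-nonZero

  φ^N~id : ∀ a → a ~ φ^ η N a
  φ^N~id a = SamePoint-trans (~-scaling-InFq InFq-η^N (pow-nonzero N η≉0) a)
                             (~-reflexive (λ d → sym (φ^-scaling η N a d)))

  module _ {α a x} (α₁≉0 : ¬ α Fin.zero ≈ 0#) (x≉0 : ¬ x ≈ 0#) (x~a : vpt α x ~ a) where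

    -- Two points of the orbit that coincide differ by η^d with η^d ∈ F_q, and 0 < d < N is impossible.
    φ^-injective-≤ : ∀ {k k′} → k ≤ k′ → k′ < N → φ^ η k a ~ φ^ η k′ a → k ≡ k′
    φ^-injective-≤ {k} {k′} k≤k′ k′<N φᵏa~φᵏ′a with k′ ∸ k ℕ.≟ 0
    ... | yes d≡0 = ℕ.≤-antisym k≤k′ (ℕ.m∸n≡0⇒m≤n d≡0)
    ... | no d≢0  = contradiction k′<N
      (ℕ.≤⇒≯ (ℕ.≤-trans (InFq-η^d⇒N≤d d (ℕ.n≢0⇒n>0 d≢0) ηᵈ∈Fq) (ℕ.m∸n≤m k′ k)))
      where
      d = k′ ∸ k

      ηᵏ′x≈ηᵈηᵏx : pow η k′ * x ≈ pow η d * (pow η k * x)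
      ηᵏ′x≈ηᵈηᵏx = begin
        pow η k′ * x                 ≡⟨ ≡.cong (λ m → pow η m * x) (≡.sym (ℕ.m+[n∸m]≡n k≤k′)) ⟩
        pow η (k ℕ.+ d) * x          ≈⟨ *-congʳ (trans (pow-+ η k d) (*-comm _ _)) ⟩
        (pow η d * pow η k) * x      ≈⟨ *-assoc _ _ _ ⟩
        pow η d * (pow η k * x)      ∎
        where open SetoidReasoning setoid

      ηᵈ∈Fq : InFq (pow η d)
      ηᵈ∈Fq = vpt~vpt⇒InFq α₁≉0 (pow-nonzero d η≉0) (*-nonzero (pow-nonzero k η≉0) x≉0) (begin
        vpt α (pow η k * x)              ≈⟨ vpt~φ^ η k x~a ⟩
        φ^ η k a                         ≈⟨ φᵏa~φᵏ′a ⟩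
        φ^ η k′ a                        ≈⟨ vpt~φ^ η k′ x~a ⟨
        vpt α (pow η k′ * x)             ≈⟨ ~-reflexive (vpt-cong α ηᵏ′x≈ηᵈηᵏx) ⟩
        vpt α (pow η d * (pow η k * x))  ∎)
        where open SetoidReasoning ~-setoid

    φ^-injective : ∀ {k k′} → k < N → k′ < N → φ^ η k a ~ φ^ η k′ a → k ≡ k′
    φ^-injective {k} {k′} k<N k′<N φᵏa~φᵏ′a with ℕ.≤-total k k′
    ... | inj₁ k≤k′ = φ^-injective-≤ k≤k′ k′<N φᵏa~φᵏ′a
    ... | inj₂ k′≤k = ≡.sym (φ^-injective-≤ k′≤k k<N (SamePoint-sym φᵏa~φᵏ′a))

    -- Writing y/x = η^j with j = k + s N, the factor (η^N)^s lies in F_q^*.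
    φ^-reaches : ∀ {b y} → ¬ y ≈ 0# → vpt α y ~ b → Σ ℕ λ k → k < N × φ^ η k a ~ b
    φ^-reaches {b} {y} y≉0 y~b = k , m%n<n j N , (begin
      φ^ η k a                        ≈⟨ vpt~φ^ η k x~a ⟨
      vpt α (pow η k * x)             ≈⟨ vpt~vpt-InFq (InFq-pow InFq-η^N s) (pow-nonzero s (pow-nonzero N η≉0)) α _ ⟩
      vpt α (pow (pow η N) s * (pow η k * x))  ≈⟨ ~-reflexive (vpt-cong α y≈) ⟨
      vpt α y                         ≈⟨ y~b ⟩
      b                               ∎)
      where
      open SetoidReasoning ~-setoid
      x⁻¹ = inv x x≉0
      j = proj₁ (proj₂ η-primitive (y * x⁻¹) (*-nonzero y≉0 (inv-nonzero x x≉0)))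
      ηʲ≈y/x : pow η j ≈ y * x⁻¹
      ηʲ≈y/x = proj₂ (proj₂ η-primitive (y * x⁻¹) (*-nonzero y≉0 (inv-nonzero x x≉0)))
      k = j % N
      s = j / N

      y≈ : y ≈ pow (pow η N) s * (pow η k * x)
      y≈ = trans (y≈y/x*x y x x≉0)
        (trans (*-congʳ (trans (sym ηʲ≈y/x) (pow-divMod η j N))) (xy∙z≈y∙xz _ _ _))

  φ^-regular : ∀ {α} → ¬ α Fin.zero ≈ 0# → ∀ a b → InV α a → InV α b →
               Σ ℕ λ k → k < N × φ^ η k a ~ b × (∀ k′ → k′ < N → φ^ η k′ a ~ b → k′ ≡ k)
  φ^-regular {α} α₁≉0 a b (x , x≉0 , x~a) (y , y≉0 , y~b) =
    let k , k<N , φᵏa~b = φ^-reaches {α} {a} {x} α₁≉0 x≉0 x~a {b} {y} y≉0 y~b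
    in k , k<N , φᵏa~b , λ k′ k′<N φᵏ′a~b →
         φ^-injective {α} {a} {x} α₁≉0 x≉0 x~a k′<N k<N
           (SamePoint-trans φᵏ′a~b (SamePoint-sym φᵏa~b))

  φ^-order-exact : ∀ m → 0 < m → m < N → Σ Coeffs λ a → IsPoint a × ¬ a ~ φ^ η m a
  φ^-order-exact m 0<m m<N = vpt ones 1# , vpt-IsPoint ones 1≉0 ,
    λ a~φᵐa → ℕ.<⇒≢ 0<m
      (φ^-injective {ones} {vpt ones 1#} {1#} 1≉0 1≉0 SamePoint-refl (ℕ.<-trans 0<m m<N) m<N a~φᵐa)

lemma4p2 : ∀ {c ℓ : Level} (R : CommutativeRing c ℓ) (q n : ℕ) →
  let open CommutativeRing R
      open Construction R q n
  in
  -- q > 2 a prime power, n ≥ 1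
  (Σ ℕ λ p → Σ ℕ λ k → Prime p × q ≡ p ^ suc k) → 2 < q → 1 ≤ n →
  -- R is a field with exactly q^{2n+1} elements, i.e. F = F_{q^{2n+1}}
  IsField → HasCard (q ^ dim) →
  -- 1) ψ_α maps V_{1,…,1} onto V_α
  ((α : Fin n → Carrier) → (∀ i → ¬ (α i ≈ 0#)) →
     ((a : Coeffs) → InV ones a → InV α (ψ α a))
     × ((b : Coeffs) → InV α b →
          Σ Coeffs λ a → InV ones a × SamePoint (M (ψ α a)) (M b)))
  ×
  -- 2) for every primitive η and N = (q^{2n+1}-1)/(q-1):
  ((η : Carrier) → IsPrimitive η → (N : ℕ) → IsOrbitSize N →
     -- φ̃ has order N as a projectivity of PG(W)
     (((a : Coeffs) → IsPoint a → SamePoint (M a) (M (φ^ η N a)))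
      × ((m : ℕ) → 0 < m → m < N →
           Σ Coeffs λ a → IsPoint a × ¬ SamePoint (M a) (M (φ^ η m a))))
     ×
     -- ⟨φ̃⟩ acts regularly on the points of V_α
     ((α : Fin n → Carrier) → (∀ i → ¬ (α i ≈ 0#)) →
        ((a : Coeffs) → InV α a → InV α (φ η a))
        × ((a b : Coeffs) → InV α a → InV α b →
             Σ ℕ λ k → k < N × SamePoint (M (φ^ η k a)) (M b)
               × ((k' : ℕ) → k' < N → SamePoint (M (φ^ η k' a)) (M b) → k' ≡ k))))
lemma4p2 R zero _ _ () _ _ _
lemma4p2 R (suc zero) _ _ (ℕ.s≤s ()) _ _ _
lemma4p2 R (suc (suc _)) zero _ _ () _ _
lemma4p2 R (suc q₁@(suc _)) (suc n₁) _ _ _ isField card =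
  (λ α _ → ψ-InV α , ψ-InV-surjective α) ,
  λ η η-primitive N N-orbitSize →
    let open Orbit R q₁ n₁ isField η-primitive card {N} N-orbitSize in
    ((λ a _ → φ^N~id a) , φ^-order-exact) ,
    λ α α≉0 → φ-InV (proj₁ η-primitive) α , φ^-regular (α≉0 Fin.zero)
  where open Points R (suc q₁) (suc n₁) isField
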